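{- Let $\mathbf t=\langle(0\,1),(0\,2),(0\,3),(1\,3),(2\,3)\rangle$, a sequence of transpositions in $\mathrm{Sym}(4)$ (its graph is a rectangle together with one of its diagonals). Then $\mathbf t$ is perm-complete, and removing any one of its five terms yields a sequence that is not perm-complete.
   Context: Permutations compose left to right. For a finite sequence $\mathbf s$ in $\mathrm{Sym}(4)$, $\bigcirc\mathbf s$ is the composite of its terms in order, $\mathrm{Seq}(\mathbf s)$ the set of its rearrangements, $\mathrm{Prod}(\mathbf s)=\{\bigcirc\mathbf r:\mathbf r\in\mathrm{Seq}(\mathbf s)\}$, and $\mathbf s$ is perm-complete iff $\mathrm{Prod}(\mathbf s)$ equals $\mathrm{Alt}(4)$ or $\mathrm{Sym}(4)\setminus\mathrm{Alt}(4)$. -}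

module Defs where

open import Data.Nat using (ℕ)
open import Data.Nat.Divisibility using (_∣_)
open import Data.Fin using (Fin; _<?_)
open import Data.Fin.Patterns
open import Data.List using (List; []; _∷_; foldl; length; filter; cartesianProduct; allFin; removeAt)
open import Data.List.Relation.Binary.Permutation.Propositional using (_↭_)
open import Data.Fin.Permutation using (Permutation′; _⟨$⟩ʳ_; _∘ₚ_; id; transpose; _≈_)
open import Data.Product using (_×_; _,_; ∃-syntax)
open import Data.Sum using (_⊎_)
open import Relation.Nullary using (¬_)
open import Relation.Nullary.Decidable using (_×-dec_)

Sym4 : Set
Sym4 = Permutation′ 4

-- Composite ○s of a sequence, composing left to right:
-- ○⟨s₁,…,sₖ⟩ = ((id ∘ₚ s₁) ∘ₚ …) ∘ₚ sₖ, where π ∘ₚ ρ applies π first, then ρ.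
○ : List Sym4 → Sym4
○ = foldl _∘ₚ_ id

inversions : Sym4 → ℕ
inversions g =
  length (filter (λ p → (Data.Product.proj₁ p <? Data.Product.proj₂ p)
                        ×-dec ((g ⟨$⟩ʳ Data.Product.proj₂ p) <? (g ⟨$⟩ʳ Data.Product.proj₁ p)))
                 (cartesianProduct (allFin 4) (allFin 4)))

InAlt4 : Sym4 → Set
InAlt4 g = 2 ∣ inversions g

InProd : List Sym4 → Sym4 → Set
InProd s g = ∃[ r ] (r ↭ s × ○ r ≈ g)

PermComplete : List Sym4 → Set
PermComplete s =
    (∀ g → (InProd s g → InAlt4 g) × (InAlt4 g → InProd s g))
  ⊎ (∀ g → (InProd s g → ¬ InAlt4 g) × (¬ InAlt4 g → InProd s g))

t : List Sym4
t = transpose 0F 1F ∷ transpose 0F 2F ∷ transpose 0F 3F ∷ transpose 1F 3F ∷ transpose 2F 3F ∷ []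

module Submission where

-- Every quantity in the statement is decidable and finite, so
-- the theorem reduces to a few exhaustive computations once each notion is
-- replaced by a computable one:
--   * a list r is a rearrangement of s  iff  r ∈ rearrangements s, an explicit
--     enumeration built by inserting the head into every position;
--   * the composite ○ r acts on Fin 4 as the function  apply r  (apply the
--     terms one after the other);
--   * the inversion count of a permutation depends only on its action, so the
--     parity of ○ r is the parity of  inversionsOf (apply r).
-- Then t is perm-complete with Prod(t) = Sym(4) ∖ Alt(4): every rearrangement
-- of t has odd product, and every odd permutation — an injective table
-- Fin 4 → Fin 4 with an odd inversion count — is the action of a rearrangement.
-- Each sequence t with one term removed is not perm-complete: its own product
-- is even (so Prod ≠ Sym(4) ∖ Alt(4)), while the even identity is not a
-- product of any of its rearrangements (so Prod ≠ Alt(4)).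

open import Defs
open import Data.Fin using (Fin; _<_; _<?_; _≟_)
open import Data.Fin.Patterns
import Data.Fin.Properties as Fin
open import Data.Nat using (ℕ)
open import Data.Nat.Divisibility using (_∣_; _∣?_; _∣0)
open import Data.List using (List; []; _∷_; _++_; [_]; map; concatMap; foldl; length; filter; cartesianProduct; allFin; removeAt)
open import Data.List.Properties using (filter-≐)
open import Data.List.Membership.Propositional using (_∈_; find; lose)
open import Data.List.Membership.Propositional.Properties using (∈-map⁺; ∈-map⁻; ∈-concatMap⁺; ∈-concatMap⁻; ∈-∃++)
open import Data.List.Relation.Unary.Any using (Any; here; there; any?)
open import Data.List.Relation.Unary.All as All using (All; all?)
open import Data.List.Relation.Binary.Permutation.Propositional using (_↭_; ↭-refl; ↭-sym; ↭-trans; prep; swap)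
open import Data.List.Relation.Binary.Permutation.Propositional.Properties using (∈-resp-↭; drop-mid; ↭-empty-inv)
open import Data.Fin.Permutation using (Permutation′; _⟨$⟩ʳ_; _⟨$⟩ˡ_; _∘ₚ_; id; inverseˡ)
open import Data.Product using (_×_; _,_; proj₁; proj₂; ∃)
open import Data.Sum using (inj₁; inj₂)
open import Function using (_∘_)
open import Function.Definitions using (Injective)
open import Relation.Nullary using (¬_; Dec)
open import Relation.Nullary.Decidable using (_×-dec_; _→-dec_; ¬?; toWitness; True)
open import Relation.Binary.PropositionalEquality using (_≡_; _≗_; refl; sym; trans; cong; subst; subst₂)

module _ {A : Set} where

  insertions : A → List A → List (List A)
  insertions x []       = [ x ] ∷ []
  insertions x (y ∷ ys) = (x ∷ y ∷ ys) ∷ map (y ∷_) (insertions x ys)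

  insertions-sound : ∀ {x r} ys → r ∈ insertions x ys → r ↭ x ∷ ys
  insertions-sound []       (here refl) = ↭-refl
  insertions-sound (y ∷ ys) (here refl) = ↭-refl
  insertions-sound {x} (y ∷ ys) (there r∈) with ∈-map⁻ (y ∷_) r∈
  ... | r′ , r′∈ , refl = ↭-trans (prep y (insertions-sound ys r′∈)) (swap y x ↭-refl)

  insertions-complete : ∀ {x} as bs → as ++ x ∷ bs ∈ insertions x (as ++ bs)
  insertions-complete []       []       = here refl
  insertions-complete []       (_ ∷ _)  = here refl
  insertions-complete (a ∷ as) bs       = there (∈-map⁺ (a ∷_) (insertions-complete as bs))

  rearrangements : List A → List (List A)
  rearrangements []       = [] ∷ []
  rearrangements (x ∷ xs) = concatMap (insertions x) (rearrangements xs)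

  rearrangements-sound : ∀ {r} s → r ∈ rearrangements s → r ↭ s
  rearrangements-sound []       (here refl) = ↭-refl
  rearrangements-sound (x ∷ xs) r∈ with find (∈-concatMap⁻ (insertions x) r∈)
  ... | r′ , r′∈ , r∈ins = ↭-trans (insertions-sound r′ r∈ins) (prep x (rearrangements-sound xs r′∈))

  -- If r ↭ x ∷ xs, then r = as ++ x ∷ bs with as ++ bs ↭ xs.
  rearrangements-complete : ∀ {r} s → r ↭ s → r ∈ rearrangements s
  rearrangements-complete []       r↭ rewrite ↭-empty-inv r↭ = here refl
  rearrangements-complete (x ∷ xs) r↭ with ∈-∃++ (∈-resp-↭ (↭-sym r↭) (here refl))
  ... | as , bs , refl =
    ∈-concatMap⁺ (insertions x)
      (lose (rearrangements-complete xs (drop-mid as [] r↭)) (insertions-complete as bs))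

apply : ∀ {n} → List (Permutation′ n) → Fin n → Fin n
apply []      i = i
apply (π ∷ r) i = apply r (π ⟨$⟩ʳ i)

foldl-apply : ∀ {n} (π : Permutation′ n) r i → foldl _∘ₚ_ π r ⟨$⟩ʳ i ≡ apply r (π ⟨$⟩ʳ i)
foldl-apply π []      i = refl
foldl-apply π (ρ ∷ r) i = foldl-apply (π ∘ₚ ρ) r i

○-apply : ∀ r i → ○ r ⟨$⟩ʳ i ≡ apply r i
○-apply = foldl-apply id

-- The inversion count of a
-- permutation in Defs is, by definition, this count applied to its action.
inversion? : ∀ {n} (f : Fin n → Fin n) (p : Fin n × Fin n) → Dec (proj₁ p < proj₂ p × f (proj₂ p) < f (proj₁ p))
inversion? f p = (proj₁ p <? proj₂ p) ×-dec (f (proj₂ p) <? f (proj₁ p))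

inversionsOf : ∀ {n} → (Fin n → Fin n) → ℕ
inversionsOf {n} f = length (filter (inversion? f) (cartesianProduct (allFin n) (allFin n)))

inversionsOf-cong : ∀ {n} {f g : Fin n → Fin n} → f ≗ g → inversionsOf f ≡ inversionsOf g
inversionsOf-cong {f = f} {g} f≗g =
  cong length (filter-≐ (inversion? f) (inversion? g) (transport f≗g , transport (sym ∘ f≗g))
                        (cartesianProduct (allFin _) (allFin _)))
  where
  transport : ∀ {h k} → h ≗ k → ∀ {p} → proj₁ p < proj₂ p × h (proj₂ p) < h (proj₁ p)
                                       → proj₁ p < proj₂ p × k (proj₂ p) < k (proj₁ p)
  transport h≗k {i , j} (i<j , hj<hi) = i<j , subst₂ _<_ (h≗k j) (h≗k i) hj<hi

inversions-○ : ∀ r → inversions (○ r) ≡ inversionsOf (apply r)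
inversions-○ r = inversionsOf-cong (○-apply r)

InProd-witness : ∀ s g → InProd s g → ∃ λ r → r ∈ rearrangements s × apply r ≗ (g ⟨$⟩ʳ_)
InProd-witness s g (r , r↭s , ○r≈g) =
  r , rearrangements-complete s r↭s , λ i → trans (sym (○-apply r i)) (○r≈g i)

InProd-intro : ∀ {s g r} → r ∈ rearrangements s → apply r ≗ (g ⟨$⟩ʳ_) → InProd s g
InProd-intro {s} {r = r} r∈ r≗g = r , rearrangements-sound s r∈ , λ i → trans (○-apply r i) (r≗g i)

products-inherit : ∀ {s} (P : ℕ → Set) → All (P ∘ inversionsOf ∘ apply) (rearrangements s) →
                   ∀ g → InProd s g → P (inversions g)
products-inherit {s} P all-r g g∈ with InProd-witness s g g∈
... | r , r∈ , r≗g = subst P (inversionsOf-cong {g = g ⟨$⟩ʳ_} r≗g) (All.lookup all-r r∈)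

-- Functions Fin 4 → Fin 4 as value tables, so that they can be enumerated.

table : Fin 4 → Fin 4 → Fin 4 → Fin 4 → Fin 4 → Fin 4
table a b c d 0F = a
table a b c d 1F = b
table a b c d 2F = c
table a b c d 3F = d

table-of : ∀ (f : Fin 4 → Fin 4) → table (f 0F) (f 1F) (f 2F) (f 3F) ≗ f
table-of f 0F = refl
table-of f 1F = refl
table-of f 2F = refl
table-of f 3F = refl

injective? : ∀ {n} (f : Fin n → Fin n) → Dec (∀ i j → f i ≡ f j → i ≡ j)
injective? f = Fin.all? λ i → Fin.all? λ j → (f i ≟ f j) →-dec (i ≟ j)

action-injective : ∀ {n} (g : Permutation′ n) → Injective _≡_ _≡_ (g ⟨$⟩ʳ_)
action-injective g gi≡gj = trans (sym (inverseˡ g)) (trans (cong (g ⟨$⟩ˡ_) gi≡gj) (inverseˡ g))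

products-of-t-odd : ∀ g → InProd t g → ¬ InAlt4 g
products-of-t-odd = products-inherit (λ k → ¬ 2 ∣ k)
  (toWitness {a? = all? (λ r → ¬? (2 ∣? inversionsOf (apply r))) (rearrangements t)} _)

OddTableCovered : Fin 4 → Fin 4 → Fin 4 → Fin 4 → Set
OddTableCovered a b c d =
  (∀ i j → table a b c d i ≡ table a b c d j → i ≡ j) → ¬ 2 ∣ inversionsOf (table a b c d) →
  Any (λ r → apply r ≗ table a b c d) (rearrangements t)

odd-tables-covered : ∀ a b c d → OddTableCovered a b c d
odd-tables-covered = toWitness {a? = Fin.all? λ a → Fin.all? λ b → Fin.all? λ c → Fin.all? λ d →
  injective? (table a b c d) →-dec (¬? (2 ∣? inversionsOf (table a b c d)) →-dec
  any? (λ r → Fin.all? λ i → apply r i ≟ table a b c d i) (rearrangements t))} _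

odd-permutations-are-products : ∀ g → ¬ InAlt4 g → InProd t g
odd-permutations-are-products g odd = from-cover (find (odd-tables-covered _ _ _ _ injective odd-table))
  where
  f : Fin 4 → Fin 4
  f = g ⟨$⟩ʳ_
  f′ : Fin 4 → Fin 4
  f′ = table (f 0F) (f 1F) (f 2F) (f 3F)
  injective : ∀ i j → f′ i ≡ f′ j → i ≡ j
  injective i j eq = action-injective g (trans (sym (table-of f i)) (trans eq (table-of f j)))
  odd-table : ¬ 2 ∣ inversionsOf f′
  odd-table = odd ∘ subst (2 ∣_) (inversionsOf-cong (table-of f))
  from-cover : ∃ (λ r → r ∈ rearrangements t × apply r ≗ f′) → InProd t g
  from-cover (r , r∈ , r≗f′) = InProd-intro {g = g} r∈ λ i → trans (r≗f′ i) (table-of f i)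

-- A sequence whose product is even but which cannot produce the identity is
-- not perm-complete: Prod(s) meets Alt(4), yet misses an element of it.
not-perm-complete : ∀ s → InAlt4 (○ s) → ¬ InProd s id → ¬ PermComplete s
not-perm-complete s even-○s id∉ (inj₁ prod≡alt) = id∉ (proj₂ (prod≡alt id) (2 ∣0))
not-perm-complete s even-○s id∉ (inj₂ prod≡odd) = proj₁ (prod≡odd (○ s)) (s , ↭-refl , λ _ → refl) even-○s

Obstructed : List Sym4 → Set
Obstructed s = 2 ∣ inversionsOf (apply s) × All (λ r → ¬ apply r ≗ (id ⟨$⟩ʳ_)) (rearrangements s)

obstructed? : ∀ s → Dec (Obstructed s)
obstructed? s = (2 ∣? inversionsOf (apply s))
         ×-dec all? (λ r → ¬? (Fin.all? λ i → apply r i ≟ i)) (rearrangements s)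

obstructed⇒not-perm-complete : ∀ s → Obstructed s → ¬ PermComplete s
obstructed⇒not-perm-complete s (even , no-id) = not-perm-complete s (subst (2 ∣_) (sym (inversions-○ s)) even) id∉
  where
  id∉ : ¬ InProd s id
  id∉ id∈ with InProd-witness s id id∈
  ... | r , r∈ , r≗id = All.lookup no-id r∈ r≗id

not-perm-complete-by-check : ∀ s → {True (obstructed? s)} → ¬ PermComplete s
not-perm-complete-by-check s {ok} = obstructed⇒not-perm-complete s (toWitness ok)

corollary2p9 : PermComplete t × ((i : Fin (length t)) → ¬ PermComplete (removeAt t i))
corollary2p9 =
  inj₂ (λ g → products-of-t-odd g , odd-permutations-are-products g) ,
  λ { 0F → not-perm-complete-by-check _
    ; 1F → not-perm-complete-by-check _
    ; 2F → not-perm-complete-by-check _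
    ; 3F → not-perm-complete-by-check _
    ; 4F → not-perm-complete-by-check _ }
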